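{- Let $\boldsymbol\ell$ and $\boldsymbol m$ be the lexicographically least and lexicographically greatest faux-bonacci binary $\omega$-words, defined as below. Then $\boldsymbol m=1\varphi^2(\boldsymbol m)$ and $\boldsymbol\ell=0\varphi^2(\boldsymbol\ell)$.
   Context: $\varphi$ is the morphism $0\mapsto 01$, $1\mapsto 0$ on $\{0,1\}$. For non-empty $X$, $X^-$ is $X$ with last letter erased; a $4^-$-power is $XXXX^-$ with $X$ non-empty; a binary word is faux-bonacci (fb) if it has no factor $11$ and no factor that is a $4^-$-power. Order words lexicographically with $0<1$. For $n\ge0$, let $\ell_n$ (resp. $m_n$) be the lexicographically least (resp. greatest) word of length $n$ that is a prefix of some fb $\omega$-word. Each $\ell_n$ is a prefix of $\ell_{n+1}$ and each $m_n$ is a prefix of $m_{n+1}$; set $\boldsymbol\ell=\lim_n\ell_n$ and $\boldsymbol m=\lim_n m_n$ (these are the lexicographically least and greatest fb $\omega$-words). -}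

module Defs where

open import Data.Bool using (Bool; true; false)
open import Data.Nat using (ℕ; zero; suc; _+_)
open import Data.List using (List; []; _∷_; _++_; length; concatMap)
open import Data.Product using (Σ; _×_; ∃; _,_)
open import Relation.Binary.PropositionalEquality using (_≡_)
open import Relation.Nullary using (¬_)

-- Letters: false = 0, true = 1 (so the order 0 < 1 is false < true).
-- ω-words are functions ℕ → Bool; finite words are List Bool.
ωWord : Set
ωWord = ℕ → Bool

pref : ℕ → ωWord → List Bool
pref zero    w = []
pref (suc n) w = w 0 ∷ pref n (λ i → w (suc i))

Factor : List Bool → ωWord → Set
Factor u w = ∃ λ i → u ≡ pref (length u) (λ j → w (i + j))

dropLast : List Bool → List Bool
dropLast []          = []
dropLast (x ∷ [])    = []
dropLast (x ∷ y ∷ u) = x ∷ dropLast (y ∷ u)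

FourMinusPower : List Bool → Set
FourMinusPower u = Σ Bool λ x → Σ (List Bool) λ xs →
  u ≡ (x ∷ xs) ++ (x ∷ xs) ++ (x ∷ xs) ++ dropLast (x ∷ xs)

FB : ωWord → Set
FB w = ¬ Factor (true ∷ true ∷ []) w × (∀ u → FourMinusPower u → ¬ Factor u w)

-- lexicographic order on finite words (used only on words of equal length)
data _≤L_ : List Bool → List Bool → Set where
  []≤L : ∀ {v} → [] ≤L v
  0<1  : ∀ {u v} → (false ∷ u) ≤L (true ∷ v)
  ∷≤L  : ∀ {b u v} → u ≤L v → (b ∷ u) ≤L (b ∷ v)

-- u is ℓₙ: the lexicographically least word of length n that is a prefix
-- of some fb ω-word (u is given as a length-n prefix below)
IsLeastPrefix : ℕ → List Bool → Set
IsLeastPrefix n u = (∃ λ v → FB v × pref n v ≡ u) × (∀ v → FB v → u ≤L pref n v)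

IsGreatestPrefix : ℕ → List Bool → Set
IsGreatestPrefix n u = (∃ λ v → FB v × pref n v ≡ u) × (∀ v → FB v → pref n v ≤L u)

-- w = lim ℓₙ, i.e. every length-n prefix of w is ℓₙ
IsEll : ωWord → Set
IsEll w = ∀ n → IsLeastPrefix n (pref n w)

IsEm : ωWord → Set
IsEm w = ∀ n → IsGreatestPrefix n (pref n w)

φ₁ : Bool → List Bool
φ₁ false = false ∷ true ∷ []
φ₁ true  = false ∷ []

φ* : List Bool → List Bool
φ* = concatMap φ₁

-- i-th letter of a finite word (default 0; only used within range)
nth : List Bool → ℕ → Bool
nth []      i       = false
nth (x ∷ u) zero    = x
nth (x ∷ u) (suc i) = nth u i

-- φ applied to an ω-word: since every image is non-empty, the i-th letter
-- of φ(w) is the i-th letter of φ(w₀ … wᵢ) (which has length ≥ i+1)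
φω : ωWord → ωWord
φω w i = nth (φ* (pref (suc i) w)) i

cons : Bool → ωWord → ωWord
cons a w zero    = a
cons a w (suc i) = w i

_≈ω_ : ωWord → ωWord → Set
u ≈ω v = ∀ i → u i ≡ v i

-- The words 𝐦 = 1φ²(𝐦) and ℓ = 0φ²(ℓ) exist as limits of iterates. The
-- substitution φ maps 4⁻-powers to 4⁻-powers and 11 to the cube 000; conversely,
-- a 4⁻-power in φ(w) forces 11 or a 4⁻-power of smaller period in w. Since 𝐦
-- and ℓ have no 11 and no 4⁻-power at their start (a finite check), induction
-- on the period shows that both are faux-bonacci. An fb word beginning with 101
-- (resp. 001) is 1φ²(v) (resp. 0φ²(v)) for some fb word v, and φ reverses the
-- lexicographic order of prefixes, so φ² preserves it; induction on the length
-- of prefixes then shows that 𝐦 and ℓ are the greatest and the least fb ω-word.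

module Submission where

open import Defs
open import Data.Bool using (Bool; true; false; not)
open import Data.Bool.Properties using (not-injective)
open import Data.Nat using (ℕ; zero; suc; _+_; _*_; _≤_; _<_; z≤n; s≤s)
open import Data.Nat.Properties
open import Data.Nat.Induction using (<-rec)
open import Algebra.Properties.CommutativeSemigroup +-commutativeSemigroup using (xy∙z≈xz∙y)
open import Data.Nat.Tactic.RingSolver using (solve-∀)
open import Data.List using (List; []; _∷_; _++_; length)
open import Data.List.Properties using (length-++; ++-assoc; ∷-injectiveˡ; ∷-injectiveʳ)
open import Data.Product using (Σ; _×_; _,_; proj₁; proj₂; ∃-syntax)
open import Data.Sum using (_⊎_; inj₁; inj₂)
open import Data.Empty using (⊥-elim)
open import Relation.Binary.PropositionalEquality
open import Relation.Nullary using (¬_)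

tail : ωWord → ωWord
tail w i = w (suc i)

drop : ℕ → ωWord → ωWord
drop j w k = w (j + k)

≈ω-sym : ∀ {u v} → u ≈ω v → v ≈ω u
≈ω-sym e i = sym (e i)

≈ω-trans : ∀ {u v w} → u ≈ω v → v ≈ω w → u ≈ω w
≈ω-trans e f i = trans (e i) (f i)

≤-witness : ∀ m d {n} → m + d ≡ n → m ≤ n
≤-witness m d refl = m≤m+n m d

caseBool : ∀ {A : Set} (b : Bool) → (b ≡ true → A) → (b ≡ false → A) → A
caseBool true  t f = t refl
caseBool false t f = f refl

nth-pref : ∀ n V k → k < n → nth (pref n V) k ≡ V k
nth-pref (suc n) V zero    _         = refl
nth-pref (suc n) V (suc k) (s≤s k<n) = nth-pref n (tail V) k k<n

length-pref : ∀ n V → length (pref n V) ≡ n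
length-pref zero    V = refl
length-pref (suc n) V = cong suc (length-pref n (tail V))

pref-cong : ∀ n {U V} → (∀ k → k < n → U k ≡ V k) → pref n U ≡ pref n V
pref-cong zero    e = refl
pref-cong (suc n) e = cong₂ _∷_ (e 0 (s≤s z≤n)) (pref-cong n (λ k k<n → e (suc k) (s≤s k<n)))

pref-++ : ∀ a b V → pref (a + b) V ≡ pref a V ++ pref b (drop a V)
pref-++ zero    b V = refl
pref-++ (suc a) b V = cong (V 0 ∷_) (pref-++ a b (tail V))

pref-period : ∀ p n V → (∀ k → k < n → V (p + k) ≡ V k) → pref (p + n) V ≡ pref p V ++ pref n V
pref-period p n V per = trans (pref-++ p n V) (cong (pref p V ++_) (pref-cong n per))

dropLast-pref : ∀ q V → dropLast (pref (suc q) V) ≡ pref q V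
dropLast-pref zero    V = refl
dropLast-pref (suc q) V = cong (V 0 ∷_) (dropLast-pref q (tail V))

nth-++ʳ : ∀ A B k → nth (A ++ B) (length A + k) ≡ nth B k
nth-++ʳ []      B k = refl
nth-++ʳ (a ∷ A) B k = nth-++ʳ A B k

nth-++ˡ : ∀ A B k → k < length A → nth (A ++ B) k ≡ nth A k
nth-++ˡ (a ∷ A) B zero    _         = refl
nth-++ˡ (a ∷ A) B (suc k) (s≤s k<n) = nth-++ˡ A B k k<n

nth-++-cong : ∀ A {B C} n → (∀ k → k < n → nth B k ≡ nth C k)
            → ∀ k → k < length A + n → nth (A ++ B) k ≡ nth (A ++ C) k
nth-++-cong []      n e k       k<n       = e k k<n
nth-++-cong (a ∷ A) n e zero    _         = refl
nth-++-cong (a ∷ A) n e (suc k) (s≤s k<n) = nth-++-cong A n e k k<n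

nth-dropLast : ∀ x xs k → k < length xs → nth (dropLast (x ∷ xs)) k ≡ nth (x ∷ xs) k
nth-dropLast x (y ∷ xs) zero    _         = refl
nth-dropLast x (y ∷ xs) (suc k) (s≤s k<n) = nth-dropLast y xs k k<n

length-dropLast : ∀ x xs → length (dropLast (x ∷ xs)) ≡ length xs
length-dropLast x []       = refl
length-dropLast x (y ∷ xs) = cong suc (length-dropLast y xs)

pref-letter : ∀ n V {u} → pref n V ≡ u → ∀ k → k < n → V k ≡ nth u k
pref-letter n V e k k<n = trans (sym (nth-pref n V k k<n)) (cong (λ u → nth u k) e)

-- The substitution φ on ω-words

-- Φ is φ on ω-words, defined letter by letter; Φ-rest b t is φ(b)φ(t)
-- without its first letter (which is always 0).
mutual
  Φ : ωWord → ωWord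
  Φ w zero    = false
  Φ w (suc i) = Φ-rest (w 0) (tail w) i

  Φ-rest : Bool → ωWord → ωWord
  Φ-rest true  t i       = Φ t i
  Φ-rest false t zero    = true
  Φ-rest false t (suc i) = Φ t i

restLength : Bool → ℕ
restLength true  = 0
restLength false = 1

blockLength : Bool → ℕ
blockLength b = suc (restLength b)

-- blockStart w j = |φ(w₀ ⋯ w_{j-1})|
blockStart : ωWord → ℕ → ℕ
blockStart w zero    = 0
blockStart w (suc j) = blockLength (w 0) + blockStart (tail w) j

Φ-rest-skip : ∀ b t k → Φ-rest b t (restLength b + k) ≡ Φ t k
Φ-rest-skip true  t k = refl
Φ-rest-skip false t k = refl

Φ-drop-blockStart : ∀ w j t → Φ w (blockStart w j + t) ≡ Φ (drop j w) t
Φ-drop-blockStart w zero    t = refl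
Φ-drop-blockStart w (suc j) t = begin
  Φ w (blockLength (w 0) + blockStart (tail w) j + t)
    ≡⟨ cong (Φ w) (+-assoc (blockLength (w 0)) _ t) ⟩
  Φ-rest (w 0) (tail w) (restLength (w 0) + (blockStart (tail w) j + t))
    ≡⟨ Φ-rest-skip (w 0) (tail w) _ ⟩
  Φ (tail w) (blockStart (tail w) j + t)
    ≡⟨ Φ-drop-blockStart (tail w) j t ⟩
  Φ (drop (suc j) w) t ∎
  where open ≡-Reasoning

Φ-blockStart : ∀ w j → Φ w (blockStart w j) ≡ false
Φ-blockStart w j = trans (cong (Φ w) (sym (+-identityʳ (blockStart w j)))) (Φ-drop-blockStart w j 0)

Φ-second : ∀ w → Φ w 1 ≡ not (w 0)
Φ-second w with w 0
... | true  = refl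
... | false = refl

-- The letter after a block start decodes the letter of w: φ(1) = 0 and φ(0) = 01.
Φ-decode : ∀ w j → Φ w (suc (blockStart w j)) ≡ not (w j)
Φ-decode w j = begin
  Φ w (suc (blockStart w j))  ≡⟨ cong (Φ w) (+-comm 1 (blockStart w j)) ⟩
  Φ w (blockStart w j + 1)    ≡⟨ Φ-drop-blockStart w j 1 ⟩
  Φ (drop j w) 1              ≡⟨ Φ-second (drop j w) ⟩
  not (w (j + 0))             ≡⟨ cong (λ i → not (w i)) (+-identityʳ j) ⟩
  not (w j)                   ∎
  where open ≡-Reasoning

Φ-decode-letter : ∀ w j {b} → Φ w (suc (blockStart w j)) ≡ not b → w j ≡ b
Φ-decode-letter w j e = not-injective (trans (sym (Φ-decode w j)) e)

Φ-zero⇒blockStart : ∀ w t → Φ w t ≡ false → ∃[ j ] blockStart w j ≡ t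
Φ-zero⇒blockStart w zero e = 0 , refl
Φ-zero⇒blockStart w (suc t) e with w 0 in w₀
Φ-zero⇒blockStart w (suc t) e | true with Φ-zero⇒blockStart (tail w) t e
... | j , p = suc j , cong₂ (λ b n → blockLength b + n) w₀ p
Φ-zero⇒blockStart w (suc zero) () | false
Φ-zero⇒blockStart w (suc (suc t)) e | false with Φ-zero⇒blockStart (tail w) t e
... | j , p = suc j , cong₂ (λ b n → blockLength b + n) w₀ p

Φ-at-zero : ∀ w x → Φ w x ≡ false → ∃[ b ] drop x (Φ w) ≈ω Φ (drop b w)
Φ-at-zero w x e with Φ-zero⇒blockStart w x e
... | b , refl = b , Φ-drop-blockStart w b

Φ-no11 : ∀ w t → Φ w (suc t) ≡ true → Φ w t ≡ false
Φ-no11 w zero e = refl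
Φ-no11 w (suc t) e with w 0
Φ-no11 w (suc t)       e | true  = Φ-no11 (tail w) t e
Φ-no11 w (suc zero)    () | false
Φ-no11 w (suc (suc t)) e | false = Φ-no11 (tail w) t e

blockStart-suc : ∀ w j → blockStart w (suc j) ≡ blockStart w j + blockLength (w j)
blockStart-suc w zero    = +-identityʳ _
blockStart-suc w (suc j) = trans (cong (blockLength (w 0) +_) (blockStart-suc (tail w) j))
                                 (sym (+-assoc (blockLength (w 0)) _ _))

nth-φ*-pref : ∀ n w i → i ≤ n → nth (φ* (pref n w)) i ≡ Φ w i
nth-φ*-pref zero    w zero    _         = refl
nth-φ*-pref (suc n) w zero    _         = first (w 0)
  where
  first : ∀ b → nth (φ* (b ∷ pref n (tail w))) 0 ≡ false
  first true  = refl
  first false = refl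
nth-φ*-pref (suc n) w (suc i) (s≤s i≤n) = rest (w 0) i i≤n
  where
  rest : ∀ b i → i ≤ n → nth (φ* (b ∷ pref n (tail w))) (suc i) ≡ Φ-rest b (tail w) i
  rest true  i       i≤n = nth-φ*-pref n (tail w) i i≤n
  rest false zero    _   = refl
  rest false (suc i) i≤n = nth-φ*-pref n (tail w) i (≤-trans (n≤1+n i) i≤n)

φω≈Φ : ∀ w → φω w ≈ω Φ w
φω≈Φ w i = nth-φ*-pref (suc i) w i (n≤1+n i)

Agree : ℕ → ωWord → ωWord → Set
Agree k u v = ∀ i → i < k → u i ≡ v i

Φ-Agree : ∀ k {u v} → Agree k u v → Agree (suc k) (Φ u) (Φ v)
Φ-Agree k {u} {v} e i (s≤s i≤k) = begin
  Φ u i                         ≡⟨ sym (nth-φ*-pref k u i i≤k) ⟩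
  nth (φ* (pref k u)) i         ≡⟨ cong (λ x → nth (φ* x) i) (pref-cong k e) ⟩
  nth (φ* (pref k v)) i         ≡⟨ nth-φ*-pref k v i i≤k ⟩
  Φ v i                         ∎
  where open ≡-Reasoning

Φ-cong : ∀ {u v} → u ≈ω v → Φ u ≈ω Φ v
Φ-cong e i = Φ-Agree i (λ j _ → e j) i ≤-refl

blockLength≤2 : ∀ b → blockLength b ≤ 2
blockLength≤2 true  = s≤s z≤n
blockLength≤2 false = ≤-refl

blockStart-true : ∀ w j → w j ≡ true → blockStart w (suc j) ≡ suc (blockStart w j)
blockStart-true w j e = trans (blockStart-suc w j) (trans (cong (λ b → blockStart w j + blockLength b) e) (+-comm (blockStart w j) 1))

blockStart-< : ∀ w t → blockStart w t < blockStart w (suc t)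
blockStart-< w t = subst (blockStart w t <_) (sym (blockStart-suc w t))
  (subst (_≤ blockStart w t + blockLength (w t)) (+-comm (blockStart w t) 1) (+-monoʳ-≤ (blockStart w t) (s≤s z≤n)))

blockStart-+-≤ : ∀ w t d → blockStart w t + d ≤ blockStart w (t + d)
blockStart-+-≤ w t zero = ≤-reflexive (trans (+-identityʳ _) (cong (blockStart w) (sym (+-identityʳ t))))
blockStart-+-≤ w t (suc d) = begin
  blockStart w t + suc d        ≡⟨ +-suc (blockStart w t) d ⟩
  suc (blockStart w t + d)      ≤⟨ s≤s (blockStart-+-≤ w t d) ⟩
  suc (blockStart w (t + d))    ≤⟨ blockStart-< w (t + d) ⟩
  blockStart w (suc (t + d))    ≡⟨ cong (blockStart w) (sym (+-suc t d)) ⟩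
  blockStart w (t + suc d)      ∎
  where open ≤-Reasoning

blockStart-periodic : ∀ w p t → (∀ s → s < t → w s ≡ w (s + p))
                    → blockStart w (t + p) ≡ blockStart w t + blockStart w p
blockStart-periodic w p zero    per = refl
blockStart-periodic w p (suc t) per = begin
  blockStart w (suc (t + p))
    ≡⟨ blockStart-suc w (t + p) ⟩
  blockStart w (t + p) + blockLength (w (t + p))
    ≡⟨ cong₂ _+_ (blockStart-periodic w p t (λ s s<t → per s (m<n⇒m<1+n s<t)))
                 (cong blockLength (sym (per t ≤-refl))) ⟩
  blockStart w t + blockStart w p + blockLength (w t)
    ≡⟨ xy∙z≈xz∙y (blockStart w t) _ _ ⟩
  blockStart w t + blockLength (w t) + blockStart w p
    ≡⟨ cong (_+ blockStart w p) (sym (blockStart-suc w t)) ⟩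
  blockStart w (suc t) + blockStart w p ∎
  where open ≡-Reasoning

-- 4⁻-powers and the faux-bonacci condition

HasEleven : ωWord → Set
HasEleven w = ∃[ j ] w j ≡ true × w (suc j) ≡ true

-- w begins with a 4⁻-power of period suc q, i.e. of length 4q + 3.
Power : ωWord → ℕ → Set
Power w q = ∀ k → k ≤ suc (3 * q) → w k ≡ w (k + suc q)

HasPower : ωWord → Set
HasPower w = ∃[ i ] ∃[ q ] Power (drop i w) q

HasEleven-drop : ∀ w j → HasEleven (drop j w) → HasEleven w
HasEleven-drop w j (i , a , b) = j + i , a , trans (cong w (sym (+-suc j i))) b

HasEleven-cong : ∀ {u v} → u ≈ω v → HasEleven u → HasEleven v
HasEleven-cong e (j , a , b) = j , trans (sym (e j)) a , trans (sym (e (suc j))) b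

Φ-noEleven : ∀ w → ¬ HasEleven (Φ w)
Φ-noEleven w (j , a , b) with trans (sym (Φ-no11 w j b)) a
... | ()

Power-cong : ∀ {u v} q → u ≈ω v → Power u q → Power v q
Power-cong q e P k k≤ = trans (sym (e k)) (trans (P k k≤) (e _))

HasPower-cong : ∀ {u v} → u ≈ω v → HasPower u → HasPower v
HasPower-cong e (i , q , P) = i , q , Power-cong q (λ t → e (i + t)) P

HasPower-tail : ∀ w → HasPower (tail w) → HasPower w
HasPower-tail w (i , q , P) = suc i , q , P

4q+2≡p+[p+q] : ∀ q → suc (suc (3 * q)) ≡ suc q + (suc q + q)
4q+2≡p+[p+q] = solve-∀

fourMinus : Bool → List Bool → List Bool
fourMinus x xs = (x ∷ xs) ++ (x ∷ xs) ++ (x ∷ xs) ++ dropLast (x ∷ xs)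

length-fourMinus : ∀ x xs → let p = suc (length xs) in length (fourMinus x xs) ≡ p + (p + (p + length xs))
length-fourMinus x xs =
  trans (length-++ X) (cong (p +_) (trans (length-++ X) (cong (p +_)
    (trans (length-++ X) (cong (p +_) (length-dropLast x xs))))))
  where
  X = x ∷ xs
  p = suc (length xs)

-- X X X X⁻ and X X X⁻ agree on the length of the latter, and the latter is X X X X⁻ shifted by |X|.
fourMinus-period : ∀ x xs k → k ≤ suc (3 * length xs)
                 → nth (fourMinus x xs) k ≡ nth (fourMinus x xs) (k + suc (length xs))
fourMinus-period x xs k k≤ = begin
  nth U k                     ≡⟨ cong (λ u → nth u k) (sym (++-assoc X X (X ++ D))) ⟩
  nth ((X ++ X) ++ X ++ D) k  ≡⟨ nth-++-cong (X ++ X) q D-prefix k k<|XX|+q ⟩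
  nth ((X ++ X) ++ D) k       ≡⟨ cong (λ u → nth u k) (++-assoc X X D) ⟩
  nth (X ++ X ++ D) k         ≡⟨ sym (nth-++ʳ X (X ++ X ++ D) k) ⟩
  nth U (suc q + k)           ≡⟨ cong (nth U) (+-comm (suc q) k) ⟩
  nth U (k + suc q)           ∎
  where
  open ≡-Reasoning
  X = x ∷ xs
  D = dropLast X
  U = fourMinus x xs
  q = length xs
  D-prefix : ∀ j → j < q → nth (X ++ D) j ≡ nth D j
  D-prefix j j<q = trans (nth-++ˡ X D j (m<n⇒m<1+n j<q)) (sym (nth-dropLast x xs j j<q))
  k<|XX|+q : k < length (X ++ X) + q
  k<|XX|+q = subst (λ n → k < n + q) (sym (length-++ X))
               (≤-trans (s≤s k≤) (≤-reflexive (trans (4q+2≡p+[p+q] q) (sym (+-assoc (suc q) _ q)))))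

Factor⇒HasPower : ∀ {u} w → FourMinusPower u → Factor u w → HasPower w
Factor⇒HasPower {u} w (x , xs , refl) (i , u≡) = i , q , power
  where
  q = length xs
  L = suc q + (suc q + (suc q + q))
  letter : ∀ k → k < L → drop i w k ≡ nth u k
  letter k k<L = trans (sym (nth-pref (length u) (drop i w) k (subst (k <_) (sym (length-fourMinus x xs)) k<L)))
                       (cong (λ v → nth v k) (sym u≡))
  shifted< : ∀ k → k ≤ suc (3 * q) → k + suc q < L
  shifted< k k≤ = ≤-trans (+-monoˡ-≤ (suc q) (s≤s k≤)) (≤-reflexive (L≡ q))
    where
    L≡ : ∀ q → suc (suc (3 * q)) + suc q ≡ suc q + (suc q + (suc q + q))
    L≡ = solve-∀
  power : Power (drop i w) q
  power k k≤ = trans (letter k (≤-trans (s≤s (m≤m+n k (suc q))) (shifted< k k≤)))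
                 (trans (fourMinus-period x xs k k≤) (sym (letter (k + suc q) (shifted< k k≤))))

HasPower⇒Factor : ∀ w → HasPower w → ∃[ u ] FourMinusPower u × Factor u w
HasPower⇒Factor w (i , q , P) = pref L V , (V 0 , pref q (tail V) , u≡) , (i , |u|≡)
  where
  V = drop i w
  p = suc q
  L = p + (p + (p + q))
  X = pref p V
  per : ∀ k → k < p + (p + q) → V (p + k) ≡ V k
  per k k< = trans (cong V (+-comm p k)) (sym (P k (≤-pred (subst (k <_) (sym (4q+2≡p+[p+q] q)) k<))))
  per-below : ∀ n → n ≤ p + (p + q) → ∀ k → k < n → V (p + k) ≡ V k
  per-below n n≤ k k<n = per k (≤-trans k<n n≤)
  u≡ : pref L V ≡ X ++ X ++ X ++ dropLast X
  u≡ = begin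
    pref (p + (p + (p + q))) V   ≡⟨ pref-period p _ V per ⟩
    X ++ pref (p + (p + q)) V    ≡⟨ cong (X ++_) (pref-period p _ V (per-below (p + q) (m≤n+m _ p))) ⟩
    X ++ X ++ pref (p + q) V     ≡⟨ cong (λ v → X ++ X ++ v) (pref-period p q V (per-below q (≤-trans (m≤n+m q p) (m≤n+m _ p)))) ⟩
    X ++ X ++ X ++ pref q V      ≡⟨ cong (λ v → X ++ X ++ X ++ v) (sym (dropLast-pref q V)) ⟩
    X ++ X ++ X ++ dropLast X    ∎
    where open ≡-Reasoning
  |u|≡ : pref L V ≡ pref (length (pref L V)) V
  |u|≡ = cong (λ n → pref n V) (sym (length-pref L V))

HasEleven⇒Factor : ∀ w → HasEleven w → Factor (true ∷ true ∷ []) w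
HasEleven⇒Factor w (j , a , b) =
  j , cong₂ _∷_ (sym (trans (cong w (+-identityʳ j)) a)) (cong (_∷ []) (sym (trans (cong w (+-comm j 1)) b)))

Factor⇒HasEleven : ∀ w → Factor (true ∷ true ∷ []) w → HasEleven w
Factor⇒HasEleven w (j , e) =
  j , sym (trans (∷-injectiveˡ e) (cong w (+-identityʳ j))) ,
      sym (trans (∷-injectiveˡ (∷-injectiveʳ e)) (cong w (+-comm j 1)))

FB-noEleven : ∀ w → FB w → ¬ HasEleven w
FB-noEleven w (no11 , _) e = no11 (HasEleven⇒Factor w e)

FB-noPower : ∀ w → FB w → ¬ HasPower w
FB-noPower w (_ , noPower) h with HasPower⇒Factor w h
... | u , fourMinus , factor = noPower u fourMinus factor

FB-intro : ∀ w → ¬ HasEleven w → ¬ HasPower w → FB w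
FB-intro w no11 noPower = (λ f → no11 (Factor⇒HasEleven w f)) , (λ u fm f → noPower (Factor⇒HasPower w fm f))

blockStart-mono-≤ : ∀ w {j N} → j ≤ N → blockStart w j ≤ blockStart w N
blockStart-mono-≤ w {j} j≤N with m≤n⇒∃[o]m+o≡n j≤N
... | d , refl = ≤-trans (m≤m+n (blockStart w j) d) (blockStart-+-≤ w j d)

blockStart-cancel-≤ : ∀ w {j N} → blockStart w j ≤ blockStart w N → j ≤ N
blockStart-cancel-≤ w {j} {N} h =
  ≮⇒≥ (λ N<j → <⇒≱ (<-≤-trans (blockStart-< w N) (blockStart-mono-≤ w N<j)) h)

blockStart-cancel-< : ∀ w {j N} → blockStart w j < blockStart w N → j < N
blockStart-cancel-< w {j} {N} h = ≰⇒> (λ N≤j → <⇒≱ h (blockStart-mono-≤ w N≤j))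

blockStart-thrice : ∀ w p → (∀ s → s < p + p → w s ≡ w (s + p))
                  → blockStart w (p + p + p) ≡ blockStart w p + blockStart w p + blockStart w p
blockStart-thrice w p per =
  trans (blockStart-periodic w p (p + p) per)
        (cong (_+ blockStart w p) (blockStart-periodic w p p (λ s s<p → per s (≤-trans s<p (m≤m+n p p)))))

-- Φ w is determined block by block: a block start stays a block start, and
-- the letter after it encodes the corresponding letter of w.
Φ-periodic : ∀ w N p → (∀ t → t < N → w t ≡ w (t + p))
           → ∀ k → k ≤ blockStart w N → Φ w k ≡ Φ w (k + blockStart w p)
Φ-periodic w N p per k k≤ = caseBool (Φ w k) (atOne k k≤) (atZero k k≤)
  where
  shift : ∀ j → j ≤ N → blockStart w j + blockStart w p ≡ blockStart w (j + p)
  shift j j≤N = sym (blockStart-periodic w p j (λ s s<j → per s (<-≤-trans s<j j≤N)))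
  atStart : ∀ j → j ≤ N → Φ w (blockStart w j) ≡ Φ w (blockStart w j + blockStart w p)
  atStart j j≤N = trans (Φ-blockStart w j) (sym (trans (cong (Φ w) (shift j j≤N)) (Φ-blockStart w (j + p))))
  afterStart : ∀ j → j < N → Φ w (suc (blockStart w j)) ≡ Φ w (suc (blockStart w j) + blockStart w p)
  afterStart j j<N = begin
    Φ w (suc (blockStart w j))                        ≡⟨ Φ-decode w j ⟩
    not (w j)                                         ≡⟨ cong not (per j j<N) ⟩
    not (w (j + p))                                   ≡⟨ sym (Φ-decode w (j + p)) ⟩
    Φ w (suc (blockStart w (j + p)))                  ≡⟨ cong (λ n → Φ w (suc n)) (sym (shift j (<⇒≤ j<N))) ⟩
    Φ w (suc (blockStart w j) + blockStart w p)       ∎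
    where open ≡-Reasoning
  atZero : ∀ k → k ≤ blockStart w N → Φ w k ≡ false → Φ w k ≡ Φ w (k + blockStart w p)
  atZero k k≤ e with Φ-zero⇒blockStart w k e
  ... | j , refl = atStart j (blockStart-cancel-≤ w k≤)
  atOne : ∀ k → k ≤ blockStart w N → Φ w k ≡ true → Φ w k ≡ Φ w (k + blockStart w p)
  atOne zero     _  ()
  atOne (suc k′) k≤ e with Φ-zero⇒blockStart w k′ (Φ-no11 w k′ e)
  ... | j , refl = afterStart j (blockStart-cancel-< w k≤)

Φ-Power : ∀ w q → Power w q → Power (Φ w) (restLength (w 0) + blockStart (tail w) q)
Φ-Power w q P k k≤ = Φ-periodic w N p (λ t t<N → P t (≤-pred t<N)) k (+-cancelʳ-≤ 2 k (blockStart w N) k+2≤)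
  where
  p = suc q
  N = suc (suc (3 * q))
  Q = restLength (w 0) + blockStart (tail w) q
  p+p≤N : p + p ≤ N
  p+p≤N = ≤-witness (p + p) q (p+p+q≡ q)
    where
    p+p+q≡ : ∀ q → suc q + suc q + q ≡ suc (suc (3 * q))
    p+p+q≡ = solve-∀
  k+2≤ : k + 2 ≤ blockStart w N + 2
  k+2≤ = begin
    k + 2                                         ≤⟨ +-monoˡ-≤ 2 k≤ ⟩
    suc (3 * Q) + 2                               ≡⟨ 3Q+3≡ Q ⟩
    suc Q + suc Q + suc Q                         ≡⟨ sym (blockStart-thrice w p (λ s s< → P s (≤-pred (≤-trans s< p+p≤N)))) ⟩
    blockStart w (p + p + p)                      ≡⟨ cong (blockStart w) (3p≡ q) ⟩
    blockStart w (suc N)                          ≡⟨ blockStart-suc w N ⟩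
    blockStart w N + blockLength (w N)            ≤⟨ +-monoʳ-≤ (blockStart w N) (blockLength≤2 (w N)) ⟩
    blockStart w N + 2                            ∎
    where
    open ≤-Reasoning
    3Q+3≡ : ∀ Q → suc (3 * Q) + 2 ≡ suc Q + suc Q + suc Q
    3Q+3≡ = solve-∀
    3p≡ : ∀ q → suc q + suc q + suc q ≡ suc (suc (suc (3 * q)))
    3p≡ = solve-∀

Φ-HasPower : ∀ w → HasPower w → HasPower (Φ w)
Φ-HasPower w (j , q , P) =
  blockStart w j , _ , Power-cong _ (λ t → sym (Φ-drop-blockStart w j t)) (Φ-Power (drop j w) q P)

cube-Power : ∀ v i → v i ≡ v (suc i) → v (suc i) ≡ v (suc (suc i)) → Power (drop i v) 0
cube-Power v i a b zero _ = trans (cong v (+-identityʳ i)) (trans a (cong v (sym (+-comm i 1))))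
cube-Power v i a b (suc zero) _ = trans (cong v (+-comm i 1)) (trans b (cong v (sym (+-comm i 2))))
cube-Power v i a b (suc (suc k)) (s≤s ())

HasEleven⇒Φ-HasPower : ∀ w → HasEleven w → HasPower (Φ w)
HasEleven⇒Φ-HasPower w (j , a , b) =
  blockStart w j , 0 , cube-Power (Φ w) (blockStart w j) (trans z₀ (sym z₁)) (trans z₁ (sym z₂))
  where
  z₀ : Φ w (blockStart w j) ≡ false
  z₀ = Φ-blockStart w j
  z₁ : Φ w (suc (blockStart w j)) ≡ false
  z₁ = subst (λ n → Φ w n ≡ false) (blockStart-true w j a) (Φ-blockStart w (suc j))
  z₂ : Φ w (suc (suc (blockStart w j))) ≡ false
  z₂ = subst (λ n → Φ w n ≡ false) (trans (blockStart-true w (suc j) b) (cong suc (blockStart-true w j a)))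
             (Φ-blockStart w (suc (suc j)))

FB-of-Φ : ∀ w → ¬ HasPower (Φ w) → FB w
FB-of-Φ w noPower = FB-intro w (λ e → noPower (HasEleven⇒Φ-HasPower w e)) (λ h → noPower (Φ-HasPower w h))

Φ-period-reflects : ∀ w p B
  → (∀ t → blockStart w t ≤ B → Φ w (suc (blockStart w t)) ≡ Φ w (suc (blockStart w t) + blockStart w p))
  → ∀ t → blockStart w t ≤ B → ∀ s → s ≤ t → w s ≡ w (s + p)
Φ-period-reflects w p B hyp = agree
  where
  letter : ∀ t → blockStart w t ≤ B → (∀ s → s < t → w s ≡ w (s + p)) → w t ≡ w (t + p)
  letter t t≤ below = Φ-decode-letter w t (begin
    Φ w (suc (blockStart w t))                         ≡⟨ hyp t t≤ ⟩
    Φ w (suc (blockStart w t) + blockStart w p)        ≡⟨ cong (λ n → Φ w (suc n)) (sym (blockStart-periodic w p t below)) ⟩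
    Φ w (suc (blockStart w (t + p)))                   ≡⟨ Φ-decode w (t + p) ⟩
    not (w (t + p))                                    ∎)
    where open ≡-Reasoning
  agree : ∀ t → blockStart w t ≤ B → ∀ s → s ≤ t → w s ≡ w (s + p)
  agree zero    t≤ .zero z≤n = letter zero t≤ (λ s ())
  agree (suc t) t≤ s s≤ with m≤n⇒m<n∨m≡n s≤
  ... | inj₁ s<    = agree t t′≤ s (≤-pred s<)
    where t′≤ = ≤-trans (<⇒≤ (blockStart-< w t)) t≤
  ... | inj₂ refl  = letter (suc t) t≤ (λ s′ s′< → agree t t′≤ s′ (≤-pred s′<))
    where t′≤ = ≤-trans (<⇒≤ (blockStart-< w t)) t≤

Φ-zero³⇒HasEleven : ∀ w x → Φ w x ≡ false → Φ w (suc x) ≡ false → Φ w (suc (suc x)) ≡ false → HasEleven w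
Φ-zero³⇒HasEleven w x a b c with Φ-zero⇒blockStart w x a
... | j , refl = j , wj , Φ-decode-letter w (suc j) (trans (cong (λ n → Φ w (suc n)) (blockStart-true w j wj)) c)
  where
  wj : w j ≡ true
  wj = Φ-decode-letter w j b

blockLength-pair : ∀ a b → (a ≡ true × b ≡ true) ⊎ 3 ≤ blockLength a + blockLength b
blockLength-pair true  true  = inj₁ (refl , refl)
blockLength-pair true  false = inj₂ ≤-refl
blockLength-pair false true  = inj₂ ≤-refl
blockLength-pair false false = inj₂ (s≤s (s≤s (s≤s z≤n)))

blockStart-+3 : ∀ w j → HasEleven w ⊎ blockStart w j + 3 ≤ blockStart w (suc (suc j))
blockStart-+3 w j with blockLength-pair (w j) (w (suc j))
... | inj₁ (a , b) = inj₁ (j , a , b)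
... | inj₂ 3≤ = inj₂ (begin
  blockStart w j + 3                                             ≤⟨ +-monoʳ-≤ (blockStart w j) 3≤ ⟩
  blockStart w j + (blockLength (w j) + blockLength (w (suc j))) ≡⟨ sym (+-assoc (blockStart w j) _ _) ⟩
  blockStart w j + blockLength (w j) + blockLength (w (suc j))   ≡⟨ cong (_+ blockLength (w (suc j))) (sym (blockStart-suc w j)) ⟩
  blockStart w (suc j) + blockLength (w (suc j))                 ≡⟨ sym (blockStart-suc w (suc j)) ⟩
  blockStart w (suc (suc j))                                     ∎)
  where open ≤-Reasoning

blockStart-> : ∀ w n → HasEleven w ⊎ suc (suc n) < blockStart w (suc (suc n))
blockStart-> w n with blockStart-+3 w 0
... | inj₁ e  = inj₁ e
... | inj₂ 3≤ = inj₂ (≤-trans (+-monoˡ-≤ n 3≤) (blockStart-+-≤ w 2 n))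

blockStart-shorter : ∀ w r q → blockStart w (suc r) ≡ suc (suc q) → HasEleven w ⊎ r < suc q
blockStart-shorter w zero     q _        = inj₂ (s≤s z≤n)
blockStart-shorter w (suc r′) q boundary with blockStart-> w r′
... | inj₁ e = inj₁ e
... | inj₂ > = inj₂ (≤-pred (subst (suc (suc r′) <_) boundary >))

-- A 4⁻-power of period p = suc (suc q) at the start of Φ w repeats its initial 0
-- at p, so p = blockStart w (suc r) for some r; unless w contains 11, w then
-- begins with a 4⁻-power of period suc r < p.
module PowerOfΦ (w : ωWord) (q : ℕ) (P : Power (Φ w) (suc q))
                (r : ℕ) (boundary : blockStart w (suc r) ≡ suc (suc q)) where

  p p′ : ℕ
  p = suc (suc q)
  p′ = suc r

  agree : ∀ t → blockStart w t ≤ 3 * suc q → ∀ s → s ≤ t → w s ≡ w (s + p′)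
  agree = Φ-period-reflects w p′ (3 * suc q) λ t t≤ →
    trans (P (suc (blockStart w t)) (s≤s t≤)) (cong (λ n → Φ w (suc (blockStart w t) + n)) (sym boundary))

  agree-first : ∀ s → s < p′ → w s ≡ w (s + p′)
  agree-first s s< = agree r r≤ s (≤-pred s<)
    where
    r≤ : blockStart w r ≤ 3 * suc q
    r≤ = ≤-trans (≤-pred (subst (blockStart w r <_) boundary (blockStart-< w r))) (≤-witness (suc q) (2 + q + q) (≡3p q))
      where
      ≡3p : ∀ q → suc q + (2 + q + q) ≡ 3 * suc q
      ≡3p = solve-∀

  twice : blockStart w (p′ + p′) ≡ p + p
  twice = trans (blockStart-periodic w p′ p′ agree-first) (cong₂ _+_ boundary boundary)

  agree-second : ∀ s → s < p′ + p′ → w s ≡ w (s + p′)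
  agree-second s s< = agree (r + p′) bound s (≤-pred s<)
    where
    bound : blockStart w (r + p′) ≤ 3 * suc q
    bound = ≤-pred (begin
      suc (blockStart w (r + p′))   ≤⟨ blockStart-< w (r + p′) ⟩
      blockStart w (p′ + p′)        ≡⟨ twice ⟩
      p + p                         ≤⟨ ≤-witness (p + p) q (2p+q≡ q) ⟩
      suc (3 * suc q)               ∎)
      where
      open ≤-Reasoning
      2p+q≡ : ∀ q → suc (suc q) + suc (suc q) + q ≡ suc (3 * suc q)
      2p+q≡ = solve-∀

  power : HasEleven w ⊎ Power w r
  power with blockStart-+3 w (suc (3 * r))
  ... | inj₁ e  = inj₁ e
  ... | inj₂ ≤+3 = inj₂ (agree (suc (3 * r)) (+-cancelʳ-≤ 3 _ _ (begin
    blockStart w (suc (3 * r)) + 3             ≤⟨ ≤+3 ⟩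
    blockStart w (suc (suc (suc (3 * r))))     ≡⟨ cong (blockStart w) (3p′≡ r) ⟩
    blockStart w (p′ + p′ + p′)                ≡⟨ blockStart-thrice w p′ agree-second ⟩
    blockStart w p′ + blockStart w p′ + blockStart w p′ ≡⟨ cong (λ n → n + n + n) boundary ⟩
    p + p + p                                  ≡⟨ 3p≡ q ⟩
    3 * suc q + 3                              ∎)))
    where
    open ≤-Reasoning
    3p′≡ : ∀ r → suc (suc (suc (3 * r))) ≡ suc r + suc r + suc r
    3p′≡ = solve-∀
    3p≡ : ∀ q → suc (suc q) + suc (suc q) + suc (suc q) ≡ 3 * suc q + 3
    3p≡ = solve-∀

ElevenOrShorterPower : ωWord → ℕ → Set
ElevenOrShorterPower w q = HasEleven w ⊎ ∃[ j ] ∃[ q′ ] q′ < q × Power (drop j w) q′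

Φ-Power-reflects : ∀ w q → Power (Φ w) q → ElevenOrShorterPower w q
Φ-Power-reflects w zero P =
  inj₁ (Φ-zero³⇒HasEleven w 0 refl (sym (P 0 z≤n)) (trans (sym (P 1 (s≤s z≤n))) (sym (P 0 z≤n))))
Φ-Power-reflects w (suc q) P with Φ-zero⇒blockStart w (suc (suc q)) (sym (P 0 z≤n))
... | zero  , ()
... | suc r , boundary with blockStart-shorter w r q boundary | PowerOfΦ.power w q P r boundary
...   | inj₁ e   | _         = inj₁ e
...   | inj₂ _   | inj₁ e    = inj₁ e
...   | inj₂ r<q | inj₂ pow  = inj₂ (0 , r , r<q , pow)

-- In Φ w a 1 is preceded by a 0, both at i + 1 and one period later.
Φ-Power-extendˡ : ∀ w i q → Φ w (suc i) ≡ true → Power (drop (suc i) (Φ w)) q → Power (drop i (Φ w)) q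
Φ-Power-extendˡ w i q one P zero _ = begin
  Φ w (i + 0)              ≡⟨ cong (Φ w) (+-identityʳ i) ⟩
  Φ w i                    ≡⟨ Φ-no11 w i one ⟩
  false                    ≡⟨ sym (Φ-no11 w (i + suc q) (trans (sym (P 0 z≤n)) (trans (cong (Φ w) (cong suc (+-identityʳ i))) one))) ⟩
  Φ w (i + suc q)          ∎
  where open ≡-Reasoning
Φ-Power-extendˡ w i q one P (suc k) k≤ = begin
  Φ w (i + suc k)               ≡⟨ cong (Φ w) (+-suc i k) ⟩
  Φ w (suc i + k)               ≡⟨ P k (≤-trans (n≤1+n k) k≤) ⟩
  Φ w (suc i + (k + suc q))     ≡⟨ cong (Φ w) (sym (+-suc i _)) ⟩
  Φ w (i + suc (k + suc q))     ∎
  where open ≡-Reasoning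

Φ-Power-blockStart : ∀ w i q → Power (drop i (Φ w)) q → ∃[ j ] Power (Φ (drop j w)) q
Φ-Power-blockStart w i q P = caseBool (Φ w i) (atOne i P) (atZero i P)
  where
  atZero : ∀ i → Power (drop i (Φ w)) q → Φ w i ≡ false → ∃[ j ] Power (Φ (drop j w)) q
  atZero i P e with Φ-zero⇒blockStart w i e
  ... | j , refl = j , Power-cong q (Φ-drop-blockStart w j) P
  atOne : ∀ i → Power (drop i (Φ w)) q → Φ w i ≡ true → ∃[ j ] Power (Φ (drop j w)) q
  atOne zero     P ()
  atOne (suc i′) P e = atZero i′ (Φ-Power-extendˡ w i′ q e P) (Φ-no11 w i′ e)

Φ-HasPower-reflects : ∀ w i q → Power (drop i (Φ w)) q → ElevenOrShorterPower w q
Φ-HasPower-reflects w i q P with Φ-Power-blockStart w i q P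
... | j , Pj with Φ-Power-reflects (drop j w) q Pj
...   | inj₁ e = inj₁ (HasEleven-drop w j e)
...   | inj₂ (k , q′ , q′<q , P′) = inj₂ (j + k , q′ , q′<q , Power-cong q′ (λ t → cong w (sym (+-assoc j k t))) P′)

-- Desubstitution

-- Φ⁻¹ u reads u as a concatenation of the blocks 0 = φ(1) and 01 = φ(0).
mutual
  Φ⁻¹ : ωWord → ωWord
  Φ⁻¹ u zero    = not (u 1)
  Φ⁻¹ u (suc i) = Φ⁻¹-rest (u 1) u i

  Φ⁻¹-rest : Bool → ωWord → ωWord
  Φ⁻¹-rest true  u = Φ⁻¹ (tail (tail u))
  Φ⁻¹-rest false u = Φ⁻¹ (tail u)

Φ-Φ⁻¹ : ∀ u → u 0 ≡ false → ¬ HasEleven u → Φ (Φ⁻¹ u) ≈ω u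
Φ-Φ⁻¹ u u₀ no11 zero    = sym u₀
Φ-Φ⁻¹ u u₀ no11 (suc t) with u 1 in u₁
Φ-Φ⁻¹ u u₀ no11 (suc zero)    | true  = sym u₁
Φ-Φ⁻¹ u u₀ no11 (suc (suc t)) | true  =
  Φ-Φ⁻¹ (tail (tail u)) (caseBool (u 2) (λ u₂ → ⊥-elim (no11 (1 , u₁ , u₂))) (λ u₂ → u₂))
        (λ e → no11 (HasEleven-drop u 2 e)) t
Φ-Φ⁻¹ u u₀ no11 (suc t)       | false = Φ-Φ⁻¹ (tail u) u₁ (λ e → no11 (HasEleven-drop u 1 e)) t

FB-desubstitute² : ∀ v → FB v → v 1 ≡ false → v 2 ≡ true → ∃[ v′ ] FB v′ × tail v ≈ω Φ (Φ v′)
FB-desubstitute² v fb v₁ v₂ = v′ , FB-of-Φ v′ noPowerΦv′ , ≈ω-trans (≈ω-sym Φx≈u) (Φ-cong (≈ω-sym Φv′≈x))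
  where
  u x v′ : ωWord
  u = tail v
  x = Φ⁻¹ u
  Φx≈u : Φ x ≈ω u
  Φx≈u = Φ-Φ⁻¹ u v₁ (λ e → FB-noEleven v fb (HasEleven-drop v 1 e))
  noPowerΦx : ¬ HasPower (Φ x)
  noPowerΦx h = FB-noPower v fb (HasPower-tail v (HasPower-cong Φx≈u h))
  v′ = Φ⁻¹ x
  Φv′≈x : Φ v′ ≈ω x
  Φv′≈x = Φ-Φ⁻¹ x (cong not v₂) (λ e → noPowerΦx (HasEleven⇒Φ-HasPower x e))
  noPowerΦv′ : ¬ HasPower (Φ v′)
  noPowerΦv′ h = FB-noPower x (FB-of-Φ x noPowerΦx) (HasPower-cong Φv′≈x h)

-- The fixed points of w ↦ 1φ²(w) and w ↦ 0φ²(w)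

-- The fixed point of w ↦ c φ²(w) as the limit of the iterates starting from the constant word c.
approx : Bool → ℕ → ωWord
approx c zero    = λ _ → c
approx c (suc f) = cons c (Φ (Φ (approx c f)))

approx-step : ∀ c f → Agree f (approx c f) (approx c (suc f))
approx-step c (suc f) zero    _         = refl
approx-step c (suc f) (suc i) (s≤s i<f) = Φ-Agree (suc f) (Φ-Agree f (approx-step c f)) i (m<n⇒m<1+n (m<n⇒m<1+n i<f))

approx-Agree : ∀ c f d → Agree f (approx c f) (approx c (f + d))
approx-Agree c f zero    i i<f = cong (λ n → approx c n i) (sym (+-identityʳ f))
approx-Agree c f (suc d) i i<f =
  trans (approx-Agree c f d i i<f)
        (trans (approx-step c (f + d) i (≤-trans i<f (m≤m+n f d))) (cong (λ n → approx c n i) (sym (+-suc f d))))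

fixpoint : Bool → ωWord
fixpoint c i = approx c (suc i) i

fixpoint-Agree : ∀ c f → Agree f (fixpoint c) (approx c f)
fixpoint-Agree c f i i<f with m≤n⇒∃[o]m+o≡n i<f
... | d , refl = approx-Agree c (suc i) d i ≤-refl

fixpoint-eq : ∀ c → fixpoint c ≈ω cons c (Φ (Φ (fixpoint c)))
fixpoint-eq c zero    = refl
fixpoint-eq c (suc x) =
  sym (Φ-Agree (suc (suc x)) (Φ-Agree (suc x) (fixpoint-Agree c (suc x))) x (m<n⇒m<1+n (m<n⇒m<1+n ≤-refl)))

cons-Φ-noEleven : ∀ c w → ¬ HasEleven (cons c (Φ w))
cons-Φ-noEleven c w (zero  , _ , ())
cons-Φ-noEleven c w (suc j , a , b) = Φ-noEleven w (j , a , b)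

Φ-cube⇒HasEleven : ∀ w i → Power (drop i (Φ w)) 0 → HasEleven w
Φ-cube⇒HasEleven w i P with Φ-HasPower-reflects w i 0 P
... | inj₁ e = e
... | inj₂ (_ , _ , () , _)

fixpoint-noEleven : ∀ c W → W ≈ω cons c (Φ (Φ W)) → ¬ HasEleven W
fixpoint-noEleven c W fix e = cons-Φ-noEleven c (Φ W) (HasEleven-cong fix e)

fixpoint-noCube : ∀ c W → W ≈ω cons c (Φ (Φ W)) → ∀ i → ¬ Power (drop (suc i) W) 0
fixpoint-noCube c W fix i P = Φ-noEleven W (Φ-cube⇒HasEleven (Φ W) i (Power-cong 0 (λ t → fix (suc (i + t))) P))

-- By induction on the period: a power of period p in W or in Φ W would, by
-- Φ-HasPower-reflects, give one of smaller period in Φ W or in W, except at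
-- the very start of W, where it is excluded by hypothesis.
FB-fixpoint : ∀ c W → W ≈ω cons c (Φ (Φ W)) → (∀ q → ¬ Power W q) → FB W
FB-fixpoint c W fix noPrefixPower =
  FB-intro W noEleven (λ (i , q , P) → proj₁ (noPower q) i P)
  where
  noEleven : ¬ HasEleven W
  noEleven = fixpoint-noEleven c W fix
  NoPower : ℕ → Set
  NoPower q = (∀ i → ¬ Power (drop i W) q) × (∀ i → ¬ Power (drop i (Φ W)) q)
  step : ∀ q → (∀ {q′} → q′ < q → NoPower q′) → NoPower q
  step q ih = inW , inΦW
    where
    inΦW : ∀ i → ¬ Power (drop i (Φ W)) q
    inΦW i P with Φ-HasPower-reflects W i q P
    ... | inj₁ e                    = noEleven e
    ... | inj₂ (j , q′ , q′<q , P′) = proj₁ (ih q′<q) j P′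
    inW : ∀ i → ¬ Power (drop i W) q
    inW zero    P = noPrefixPower q P
    inW (suc i) P with Φ-HasPower-reflects (Φ W) i q (Power-cong q (λ t → fix (suc (i + t))) P)
    ... | inj₁ e                    = Φ-noEleven W e
    ... | inj₂ (j , q′ , q′<q , P′) = proj₂ (ih q′<q) j P′
  noPower : ∀ q → NoPower q
  noPower = <-rec NoPower step

Φ-tail-1 : ∀ v → v 0 ≡ true → tail (Φ v) ≈ω Φ (tail v)
Φ-tail-1 v e with v 0
... | true = λ _ → refl

Φ-tail-01 : ∀ v → v 0 ≡ false → tail (tail (Φ v)) ≈ω Φ (tail v)
Φ-tail-01 v e with v 0
... | false = λ _ → refl

Φ-decode-1 : ∀ v → Φ v 1 ≡ false → v 0 ≡ true × tail (Φ v) ≈ω Φ (tail v)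
Φ-decode-1 v e = v₀ , Φ-tail-1 v v₀
  where v₀ = not-injective (trans (sym (Φ-second v)) e)

Φ-decode-01 : ∀ v → Φ v 1 ≡ true → v 0 ≡ false × tail (tail (Φ v)) ≈ω Φ (tail v)
Φ-decode-01 v e = v₀ , Φ-tail-01 v v₀
  where v₀ = not-injective (trans (sym (Φ-second v)) e)

-- φ(000) = 010101
Φ-010101⇒cube : ∀ v → Φ v 1 ≡ true → Φ v 3 ≡ true → Φ v 5 ≡ true → Power v 0
Φ-010101⇒cube v h₁ h₃ h₅ = cube-Power v 0 (trans v₀ (sym v₁)) (trans v₁ (sym v₂))
  where
  d₀ = Φ-decode-01 v h₁
  d₁ = Φ-decode-01 (tail v) (trans (sym (proj₂ d₀ 1)) h₃)
  d₂ = Φ-decode-01 (tail (tail v)) (trans (sym (proj₂ d₁ 1)) (trans (sym (proj₂ d₀ 3)) h₅))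
  v₀ = proj₁ d₀
  v₁ = proj₁ d₁
  v₂ = proj₁ d₂

-- φ(10101) = 0010010
Φ-0010010⇒10101 : ∀ v → Φ v 1 ≡ false → Φ v 2 ≡ true → Φ v 4 ≡ false → Φ v 5 ≡ true → Φ v 7 ≡ false
                → v 0 ≡ true × v 2 ≡ true × v 4 ≡ true
Φ-0010010⇒10101 v h₁ h₂ h₄ h₅ h₇ = proj₁ d₀ , proj₁ d₂ , proj₁ d₄
  where
  d₀ = Φ-decode-1 v h₁
  e₀ = proj₂ d₀
  d₁ = Φ-decode-01 (tail v) (trans (sym (e₀ 1)) h₂)
  e₁ = proj₂ d₁
  d₂ = Φ-decode-1 (drop 2 v) (trans (sym (e₁ 1)) (trans (sym (e₀ 3)) h₄))
  e₂ = proj₂ d₂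
  d₃ = Φ-decode-01 (drop 3 v) (trans (sym (e₂ 1)) (trans (sym (e₁ 2)) (trans (sym (e₀ 4)) h₅)))
  e₃ = proj₂ d₃
  d₄ = Φ-decode-1 (drop 4 v)
         (trans (sym (e₃ 1)) (trans (sym (e₂ 3)) (trans (sym (e₁ 4)) (trans (sym (e₀ 6)) h₇))))

Φ-10101⇒cube : ∀ w x → drop x (Φ w) 0 ≡ true → drop x (Φ w) 2 ≡ true → drop x (Φ w) 4 ≡ true
             → ∃[ c ] Power (drop c w) 0
Φ-10101⇒cube w zero    () _ _
Φ-10101⇒cube w (suc x) h₀ h₂ h₄ with Φ-at-zero w x (Φ-no11 w x (trans (cong (λ i → Φ w (suc i)) (sym (+-identityʳ x))) h₀))
... | c , e = c , Φ-010101⇒cube (drop c w) (shift 0 h₀) (shift 2 h₂) (shift 4 h₄)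
  where
  shift : ∀ j → drop (suc x) (Φ w) j ≡ true → Φ (drop c w) (suc j) ≡ true
  shift j h = trans (sym (e (suc j))) (trans (cong (Φ w) (+-suc x j)) h)

fixpoint-Power : ∀ c W → W ≈ω cons c (Φ (Φ W)) → ∀ q → Power W q
               → ∀ k → k ≤ suc (3 * q) → drop q (Φ (Φ W)) k ≡ W k
fixpoint-Power c W fix q P k k≤ =
  trans (sym (fix (suc (q + k)))) (trans (cong W (sym (trans (+-suc k q) (cong suc (+-comm k q))))) (sym (P k k≤)))

-- abstract keeps the type checker from unfolding the fixed points beyond the prefixes computed here.
abstract
  m∞ : ωWord
  m∞ = fixpoint true

  m∞-fix : m∞ ≈ω cons true (Φ (Φ m∞))
  m∞-fix = fixpoint-eq true

  m∞-prefix : pref 5 m∞ ≡ true ∷ false ∷ true ∷ false ∷ true ∷ []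
  m∞-prefix = refl

  ℓ∞ : ωWord
  ℓ∞ = fixpoint false

  ℓ∞-fix : ℓ∞ ≈ω cons false (Φ (Φ ℓ∞))
  ℓ∞-fix = fixpoint-eq false

  ℓ∞-prefix : pref 8 ℓ∞ ≡ false ∷ false ∷ true ∷ false ∷ false ∷ true ∷ false ∷ false ∷ []
  ℓ∞-prefix = refl

m∞-letter : ∀ k → k < 5 → m∞ k ≡ nth (true ∷ false ∷ true ∷ false ∷ true ∷ []) k
m∞-letter = pref-letter 5 m∞ m∞-prefix

ℓ∞-letter : ∀ k → k < 8 → ℓ∞ k ≡ nth (false ∷ false ∷ true ∷ false ∷ false ∷ true ∷ false ∷ false ∷ []) k
ℓ∞-letter = pref-letter 8 ℓ∞ ℓ∞-prefix

m∞-noPrefixPower : ∀ q → ¬ Power m∞ q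
m∞-noPrefixPower zero P with trans (sym (m∞-letter 0 (s≤s z≤n))) (trans (P 0 z≤n) (m∞-letter 1 (s≤s (s≤s z≤n))))
... | ()
m∞-noPrefixPower (suc q) P =
  fixpoint-noEleven true m∞ m∞-fix (Φ-cube⇒HasEleven m∞ (proj₁ cube) (proj₂ cube))
  where
  n : ωWord
  n = Φ m∞
  one : ∀ k → k ≤ 4 → m∞ k ≡ true → drop (suc q) (Φ n) k ≡ true
  one k k≤ e = trans (fixpoint-Power true m∞ m∞-fix (suc q) P k (≤-trans k≤ (≤-witness 4 (3 * q) (4+3q≡ q)))) e
    where
    4+3q≡ : ∀ q → 4 + 3 * q ≡ suc (3 * suc q)
    4+3q≡ = solve-∀
  cube : ∃[ c ] Power (drop c n) 0
  cube = Φ-10101⇒cube n (suc q) (one 0 z≤n (m∞-letter 0 (s≤s z≤n)))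
                                (one 2 (s≤s (s≤s z≤n)) (m∞-letter 2 (s≤s (s≤s (s≤s z≤n)))))
                                (one 4 ≤-refl (m∞-letter 4 ≤-refl))

ℓ∞-noPrefixPower : ∀ q → ¬ Power ℓ∞ q
ℓ∞-noPrefixPower zero P with trans (sym (ℓ∞-letter 1 (s≤s (s≤s z≤n)))) (trans (P 1 (s≤s z≤n)) (ℓ∞-letter 2 (s≤s (s≤s (s≤s z≤n)))))
... | ()
ℓ∞-noPrefixPower (suc zero) P with trans (sym (ℓ∞-letter 0 (s≤s z≤n))) (trans (P 0 z≤n) (ℓ∞-letter 2 (s≤s (s≤s (s≤s z≤n)))))
... | ()
ℓ∞-noPrefixPower (suc (suc q)) P = noCube (proj₁ cube) (proj₂ cube)
  where
  n : ωWord
  n = Φ ℓ∞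
  again : ∀ k → k ≤ 7 → drop (suc (suc q)) (Φ n) k ≡ ℓ∞ k
  again k k≤ = fixpoint-Power false ℓ∞ ℓ∞-fix (suc (suc q)) P k (≤-trans k≤ (≤-witness 7 (3 * q) (7+3q≡ q)))
    where
    7+3q≡ : ∀ q → 7 + 3 * q ≡ suc (3 * suc (suc q))
    7+3q≡ = solve-∀
  block : ∃[ b ] drop (suc (suc q)) (Φ n) ≈ω Φ (drop b n)
  block = Φ-at-zero n (suc (suc q)) (trans (cong (Φ n) (sym (+-identityʳ (suc (suc q)))))
                                           (trans (again 0 z≤n) (ℓ∞-letter 0 (s≤s z≤n))))
  b : ℕ
  b = proj₁ block
  at : ∀ k → k ≤ 7 → Φ (drop b n) k ≡ nth (false ∷ false ∷ true ∷ false ∷ false ∷ true ∷ false ∷ false ∷ []) k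
  at k k≤ = trans (sym (proj₂ block k)) (trans (again k k≤) (ℓ∞-letter k (s≤s k≤)))
  ones : drop b n 0 ≡ true × drop b n 2 ≡ true × drop b n 4 ≡ true
  ones = Φ-0010010⇒10101 (drop b n)
    (at 1 (s≤s z≤n)) (at 2 (s≤s (s≤s z≤n))) (at 4 (s≤s (s≤s (s≤s (s≤s z≤n)))))
    (at 5 (s≤s (s≤s (s≤s (s≤s (s≤s z≤n)))))) (at 7 ≤-refl)
  cube : ∃[ c ] Power (drop c ℓ∞) 0
  cube = Φ-10101⇒cube ℓ∞ b (proj₁ ones) (proj₁ (proj₂ ones)) (proj₂ (proj₂ ones))
  noCube : ∀ c → ¬ Power (drop c ℓ∞) 0
  noCube zero    P with trans (sym (ℓ∞-letter 1 (s≤s (s≤s z≤n)))) (trans (P 1 (s≤s z≤n)) (ℓ∞-letter 2 (s≤s (s≤s (s≤s z≤n)))))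
  ... | ()
  noCube (suc c) = fixpoint-noCube false ℓ∞ ℓ∞-fix c

FB-m∞ : FB m∞
FB-m∞ = FB-fixpoint true m∞ m∞-fix m∞-noPrefixPower

FB-ℓ∞ : FB ℓ∞
FB-ℓ∞ = FB-fixpoint false ℓ∞ ℓ∞-fix ℓ∞-noPrefixPower

-- Extremality in the lexicographic order

≤L-∷⁻ : ∀ {a b as bs} → (a ∷ as) ≤L (b ∷ bs) → (a ≡ false × b ≡ true) ⊎ (a ≡ b × as ≤L bs)
≤L-∷⁻ 0<1      = inj₁ (refl , refl)
≤L-∷⁻ (∷≤L h) = inj₂ (refl , h)

≤L-< : ∀ {a b as bs} → a ≡ false → b ≡ true → (a ∷ as) ≤L (b ∷ bs)
≤L-< refl refl = 0<1

≤L-∷ : ∀ {a b as bs} → a ≡ b → as ≤L bs → (a ∷ as) ≤L (b ∷ bs)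
≤L-∷ refl h = ∷≤L h

≤L-antisym : ∀ {xs ys} → xs ≤L ys → ys ≤L xs → xs ≡ ys
≤L-antisym []≤L    []≤L    = refl
≤L-antisym 0<1     ()
≤L-antisym (∷≤L h) (∷≤L h′) = cong (_ ∷_) (≤L-antisym h h′)

pref-≤L-init : ∀ n u v → pref (suc n) u ≤L pref (suc n) v → pref n u ≤L pref n v
pref-≤L-init zero    u v h = []≤L
pref-≤L-init (suc n) u v h with ≤L-∷⁻ h
... | inj₁ (a , b)  = ≤L-< a b
... | inj₂ (e , h′) = ≤L-∷ e (pref-≤L-init n (tail u) (tail v) h′)

Φ-antitone : ∀ n u u′ → pref n u ≤L pref n u′ → pref (suc n) (Φ u′) ≤L pref (suc n) (Φ u)
Φ-antitone zero    u u′ h = ∷≤L []≤L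
Φ-antitone (suc n) u u′ h with ≤L-∷⁻ h
... | inj₁ (u₀ , u′₀) = ∷≤L (≤L-< (trans (Φ-second u′) (cong not u′₀)) (trans (Φ-second u) (cong not u₀)))
... | inj₂ (e , h′) = ∷≤L (caseBool (u′ 0) one zero-one)
  where
  ih = Φ-antitone n (tail u) (tail u′) h′
  one : u′ 0 ≡ true → pref (suc n) (tail (Φ u′)) ≤L pref (suc n) (tail (Φ u))
  one u′₀ = subst₂ _≤L_ (pref-cong (suc n) (λ k _ → sym (Φ-tail-1 u′ u′₀ k)))
                        (pref-cong (suc n) (λ k _ → sym (Φ-tail-1 u (trans e u′₀) k))) ih
  zero-one : u′ 0 ≡ false → pref (suc n) (tail (Φ u′)) ≤L pref (suc n) (tail (Φ u))
  zero-one u′₀ = ≤L-∷ (trans (Φ-second u′) (trans (cong not (sym e)) (sym (Φ-second u))))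
    (subst₂ _≤L_ (pref-cong n (λ k _ → sym (Φ-tail-01 u′ u′₀ k)))
                 (pref-cong n (λ k _ → sym (Φ-tail-01 u (trans e u′₀) k))) (pref-≤L-init n _ _ ih))

Φ²-monotone : ∀ n u v → (∀ k → k < n → pref k u ≤L pref k v) → pref n (Φ (Φ u)) ≤L pref n (Φ (Φ v))
Φ²-monotone zero          u v h = []≤L
Φ²-monotone (suc zero)    u v h = ∷≤L []≤L
Φ²-monotone (suc (suc k)) u v h = Φ-antitone (suc k) (Φ v) (Φ u) (Φ-antitone k u v (h k (n≤1+n (suc k))))

cons-Φ²-monotone : ∀ n v w v′ w′ → v 0 ≡ w 0 → tail v ≈ω Φ (Φ v′) → tail w ≈ω Φ (Φ w′)
                 → (∀ k → k < n → pref k v′ ≤L pref k w′) → pref (suc n) v ≤L pref (suc n) w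
cons-Φ²-monotone n v w v′ w′ e v≈ w≈ h =
  ≤L-∷ e (subst₂ _≤L_ (pref-cong n (λ k _ → sym (v≈ k))) (pref-cong n (λ k _ → sym (w≈ k))) (Φ²-monotone n v′ w′ h))

FB-no11 : ∀ v → FB v → ∀ j → v j ≡ true → v (suc j) ≡ false
FB-no11 v fb j vⱼ = caseBool (v (suc j)) (λ e → ⊥-elim (FB-noEleven v fb (j , vⱼ , e))) (λ e → e)

FB-no000 : ∀ v → FB v → v 0 ≡ false → v 1 ≡ false → v 2 ≡ true
FB-no000 v fb v₀ v₁ = caseBool (v 2) (λ e → e)
  (λ v₂ → ⊥-elim (FB-noPower v fb (0 , 0 , cube-Power v 0 (trans v₀ (sym v₁)) (trans v₁ (sym v₂)))))

m∞-greatest : ∀ n v → FB v → pref n v ≤L pref n m∞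
m∞-greatest = <-rec (λ n → ∀ v → FB v → pref n v ≤L pref n m∞) step
  where
  m₀ : m∞ 0 ≡ true
  m₀ = m∞-letter 0 (s≤s z≤n)
  m₁ : m∞ 1 ≡ false
  m₁ = m∞-letter 1 (s≤s (s≤s z≤n))
  m₂ : m∞ 2 ≡ true
  m₂ = m∞-letter 2 (s≤s (s≤s (s≤s z≤n)))
  step : ∀ n → (∀ {k} → k < n → ∀ v → FB v → pref k v ≤L pref k m∞) → ∀ v → FB v → pref n v ≤L pref n m∞
  step zero    ih v fb = []≤L
  step (suc n) ih v fb = caseBool (v 0) starts1 (λ v₀ → ≤L-< v₀ m₀)
    where
    starts1 : v 0 ≡ true → pref (suc n) v ≤L pref (suc n) m∞
    starts1 v₀ = caseBool (v 2) starts101 (starts100 n)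
      where
      v₁ : v 1 ≡ false
      v₁ = FB-no11 v fb 0 v₀
      starts100 : ∀ n → v 2 ≡ false → pref (suc n) v ≤L pref (suc n) m∞
      starts100 zero          v₂ = ≤L-∷ (trans v₀ (sym m₀)) []≤L
      starts100 (suc zero)    v₂ = ≤L-∷ (trans v₀ (sym m₀)) (≤L-∷ (trans v₁ (sym m₁)) []≤L)
      starts100 (suc (suc k)) v₂ = ≤L-∷ (trans v₀ (sym m₀)) (≤L-∷ (trans v₁ (sym m₁)) (≤L-< v₂ m₂))
      starts101 : v 2 ≡ true → pref (suc n) v ≤L pref (suc n) m∞
      starts101 v₂ = cons-Φ²-monotone n v m∞ (proj₁ d) m∞ (trans v₀ (sym m₀)) (proj₂ (proj₂ d)) (λ k → m∞-fix (suc k))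
                              (λ k k<n → ih (m<n⇒m<1+n k<n) (proj₁ d) (proj₁ (proj₂ d)))
        where
        d : ∃[ v′ ] FB v′ × tail v ≈ω Φ (Φ v′)
        d = FB-desubstitute² v fb v₁ v₂

ℓ∞-least : ∀ n v → FB v → pref n ℓ∞ ≤L pref n v
ℓ∞-least = <-rec (λ n → ∀ v → FB v → pref n ℓ∞ ≤L pref n v) step
  where
  ℓ₀ : ℓ∞ 0 ≡ false
  ℓ₀ = ℓ∞-letter 0 (s≤s z≤n)
  ℓ₁ : ℓ∞ 1 ≡ false
  ℓ₁ = ℓ∞-letter 1 (s≤s (s≤s z≤n))
  step : ∀ n → (∀ {k} → k < n → ∀ v → FB v → pref k ℓ∞ ≤L pref k v) → ∀ v → FB v → pref n ℓ∞ ≤L pref n v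
  step zero    ih v fb = []≤L
  step (suc n) ih v fb = caseBool (v 0) (λ v₀ → ≤L-< ℓ₀ v₀) starts0
    where
    starts0 : v 0 ≡ false → pref (suc n) ℓ∞ ≤L pref (suc n) v
    starts0 v₀ = caseBool (v 1) (starts01 n) starts00
      where
      starts01 : ∀ n → v 1 ≡ true → pref (suc n) ℓ∞ ≤L pref (suc n) v
      starts01 zero    v₁ = ≤L-∷ (trans ℓ₀ (sym v₀)) []≤L
      starts01 (suc k) v₁ = ≤L-∷ (trans ℓ₀ (sym v₀)) (≤L-< ℓ₁ v₁)
      starts00 : v 1 ≡ false → pref (suc n) ℓ∞ ≤L pref (suc n) v
      starts00 v₁ = cons-Φ²-monotone n ℓ∞ v ℓ∞ (proj₁ d) (trans ℓ₀ (sym v₀)) (λ k → ℓ∞-fix (suc k)) (proj₂ (proj₂ d))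
                      (λ k k<n → ih (m<n⇒m<1+n k<n) (proj₁ d) (proj₁ (proj₂ d)))
        where
        d : ∃[ v′ ] FB v′ × tail v ≈ω Φ (Φ v′)
        d = FB-desubstitute² v fb v₁ (FB-no000 v fb v₀ v₁)

pref-last : ∀ i u v → pref (suc i) u ≡ pref (suc i) v → u i ≡ v i
pref-last i u v e = trans (pref-letter (suc i) u e i ≤-refl) (nth-pref (suc i) v i ≤-refl)

m∞-IsEm : IsEm m∞
m∞-IsEm n = (m∞ , FB-m∞ , refl) , λ v fb → m∞-greatest n v fb

ℓ∞-IsEll : IsEll ℓ∞
ℓ∞-IsEll n = (ℓ∞ , FB-ℓ∞ , refl) , λ v fb → ℓ∞-least n v fb

IsEm-unique : ∀ m → IsEm m → m ≈ω m∞
IsEm-unique m h i =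
  let ((v , fb , v≡m) , greatest) = h (suc i)
  in pref-last i m m∞ (≤L-antisym (subst (_≤L pref (suc i) m∞) v≡m (m∞-greatest (suc i) v fb)) (greatest m∞ FB-m∞))

IsEll-unique : ∀ l → IsEll l → l ≈ω ℓ∞
IsEll-unique l h i =
  let ((v , fb , v≡l) , least) = h (suc i)
  in pref-last i l ℓ∞ (≤L-antisym (least ℓ∞ FB-ℓ∞) (subst (pref (suc i) ℓ∞ ≤L_) v≡l (ℓ∞-least (suc i) v fb)))

fixpoint-transfer : ∀ c W w → W ≈ω cons c (Φ (Φ W)) → w ≈ω W → w ≈ω cons c (φω (φω w))
fixpoint-transfer c W w fix w≈ zero    = trans (w≈ 0) (fix 0)
fixpoint-transfer c W w fix w≈ (suc i) = begin
  w (suc i)          ≡⟨ w≈ (suc i) ⟩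
  W (suc i)          ≡⟨ fix (suc i) ⟩
  Φ (Φ W) i          ≡⟨ Φ-cong (Φ-cong (≈ω-sym w≈)) i ⟩
  Φ (Φ w) i          ≡⟨ Φ-cong (≈ω-sym (φω≈Φ w)) i ⟩
  Φ (φω w) i         ≡⟨ sym (φω≈Φ (φω w) i) ⟩
  φω (φω w) i        ∎
  where open ≡-Reasoning

theorem8 : (Σ ωWord IsEm × (∀ m → IsEm m → m ≈ω cons true (φω (φω m))))
         × (Σ ωWord IsEll × (∀ l → IsEll l → l ≈ω cons false (φω (φω l))))
theorem8 = ((m∞ , m∞-IsEm) , λ m h → fixpoint-transfer true m∞ m m∞-fix (IsEm-unique m h))
         , ((ℓ∞ , ℓ∞-IsEll) , λ l h → fixpoint-transfer false ℓ∞ l ℓ∞-fix (IsEll-unique l h))
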